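{- Let $N=\{1,\ldots,n\}$ and let $\mathcal F\subseteq 2^N$ be a family with $\emptyset\in\mathcal F$ and $\{i\}\in\mathcal F$ for all $i\in N$, and let $w:\mathcal F\to\mathbb R_+$ with $w(\emptyset)=0$. Let $P$ be a partition of $N$ all of whose blocks belong to $\mathcal F$, with associated $\mathbf p\in\bar\Delta_N$. If for every block $A\in P$ and every $i\in A$ $$w(A)\ge w(\{i\})+\sum_{\hat B\in\mathcal F\cap 2^{A\setminus\{i\}}}\mu^w(\hat B),$$ then $\mathbf p$ is a local maximizer of $W:\bar\Delta_N\to\mathbb R$.
   Context: The Möbius inversion of $w$ on the poset $(\mathcal F,\subseteq)$ is defined recursively by $\mu^w(A)=w(A)-\sum_{B\in\mathcal F,\,B\subset A}\mu^w(B)$ (strict inclusion; so $\mu^w(\emptyset)=0$). For $i\in N$ let $\mathcal F_i=\{A\in\mathcal F:i\in A\}$ and $\bar\Delta_i=\{q_i=(q_i^A)_{A\in\mathcal F_i}\in\mathbb R_+^{\mathcal F_i}:\sum_{A\in\mathcal F_i}q_i^A=1\}$; fuzzy covers are $\mathbf q=(q_1,\ldots,q_n)\in\bar\Delta_N=\times_{i\in N}\bar\Delta_i$, with $q_i^A=0$ if $i\notin A$, and $\mathbf q=q_i|\mathbf q_{ -i}$ where $\mathbf q_{ -i}=(q_j)_{j\ne i}$. Global worth: $W(\mathbf q)=\sum_{A\in\mathcal F}\sum_{B\in\mathcal F\cap 2^A}\left(\prod_{i\in B}q_i^A\right)\mu^w(B)$ (empty product $=1$). For $i\in N$: $W_i(q_i|\mathbf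 q_{ -i})=\sum_{A\in\mathcal F_i}q_i^A\left[\sum_{B\in\mathcal F_i\cap 2^A}\left(\prod_{j\in B\setminus\{i\}}q_j^A\right)\mu^w(B)\right]$. A point $\hat{\mathbf q}\in\bar\Delta_N$ is a local maximizer of $W$ if $W_i(\hat q_i|\hat{\mathbf q}_{ -i})\ge W_i(q_i|\hat{\mathbf q}_{ -i})$ for all $i\in N$ and all $q_i\in\bar\Delta_i$. The fuzzy cover associated with a partition $P$ is $\mathbf p$ with $p_i^A=1$ if $A\in P$ and $i\in A$, and $p_i^A=0$ otherwise. -}

module Defs where

open import Level using (Level; _⊔_) renaming (suc to lsuc)
open import Data.Nat using (ℕ; zero; suc)
open import Data.Bool using (Bool; true; false; if_then_else_; _∧_; not)
open import Data.List using (List; []; _∷_; _++_; map; foldr; filter)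
open import Data.Vec using (_∷_; [])
open import Data.Fin using (Fin)
open import Data.Fin.Subset using (Subset; _∈_; _⊆_; _⊂_; ⁅_⁆; ⊥; Nonempty) renaming (_-_ to _without_)
open import Data.Fin.Subset.Properties using (_∈?_; _⊆?_; _⊂?_)
open import Data.Fin.Properties using (_≟_)
open import Data.List using (allFin)
open import Data.Product using (Σ; ∃; _×_; _,_)
open import Relation.Nullary using (¬_; does)
open import Relation.Binary using (Rel; IsTotalOrder)
open import Relation.Binary.PropositionalEquality using (_≡_)
open import Algebra.Bundles using (CommutativeRing)

-- Ordered fields (stand-in for ℝ)

record OrderedField (c ℓ₁ ℓ₂ : Level) : Set (lsuc (c ⊔ ℓ₁ ⊔ ℓ₂)) where
  field
    commutativeRing : CommutativeRing c ℓ₁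
  open CommutativeRing commutativeRing public
  field
    _≤_          : Rel Carrier ℓ₂
    isTotalOrder : IsTotalOrder _≈_ _≤_
    +-monoʳ      : ∀ {a b} c → a ≤ b → (a + c) ≤ (b + c)
    *-nonneg     : ∀ {a b} → 0# ≤ a → 0# ≤ b → 0# ≤ (a * b)
    0≉1          : ¬ (0# ≈ 1#)
    inverse      : ∀ a → ¬ (a ≈ 0#) → ∃ λ b → (a * b) ≈ 1#

allSubsets : (n : ℕ) → List (Subset n)
allSubsets zero    = [] ∷ []
allSubsets (suc n) = map (true ∷_) (allSubsets n) ++ map (false ∷_) (allSubsets n)

Family : ℕ → Set
Family n = Subset n → Bool

_∈ᶠ_ : ∀ {n} → Subset n → Family n → Set
A ∈ᶠ F = F A ≡ true

module WithField {c ℓ₁ ℓ₂} (R : OrderedField c ℓ₁ ℓ₂) where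
  open OrderedField R

  Σ-list : ∀ {A : Set} → List A → (A → Carrier) → Carrier
  Σ-list xs f = foldr (λ x acc → f x + acc) 0# xs

  Π-list : ∀ {A : Set} → List A → (A → Carrier) → Carrier
  Π-list xs f = foldr (λ x acc → f x * acc) 1# xs

  ΣF : ∀ {n} → Family n → (Subset n → Bool) → (Subset n → Carrier) → Carrier
  ΣF {n} F t f = Σ-list (filter (λ B → F B ∧ t B ≟b true) (allSubsets n)) f
    where
    open import Data.Bool.Properties renaming (_≟_ to _≟b_)

  -- Möbius inversion of w on (F, ⊆):
  --   μ(A) = w(A) − Σ_{B ∈ F, B ⊂ A} μ(B).
  -- Computed with fuel; fuel k is enough when |A| ≤ k, and we use fuel n.
  mobiusFuel : ∀ {n} → ℕ → Family n → (Subset n → Carrier) → Subset n → Carrier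
  mobiusFuel zero    F w A = w A
  mobiusFuel (suc k) F w A = w A - ΣF F (λ B → does (B ⊂? A)) (mobiusFuel k F w)

  mobius : ∀ {n} → Family n → (Subset n → Carrier) → Subset n → Carrier
  mobius {n} F w = mobiusFuel n F w

  -- Profiles: q i A stands for q_i^A (only A ∈ F_i are meaningful).
  Profile : ℕ → Set c
  Profile n = Fin n → Subset n → Carrier

  InSimplex : ∀ {n} → Family n → Fin n → (Subset n → Carrier) → Set (ℓ₁ ⊔ ℓ₂)
  InSimplex F i qi =
    (∀ A → A ∈ᶠ F → i ∈ A → 0# ≤ qi A) ×
    (ΣF F (λ A → does (i ∈? A)) qi ≈ 1#)

  InSimplexN : ∀ {n} → Family n → Profile n → Set (ℓ₁ ⊔ ℓ₂)
  InSimplexN F q = ∀ i → InSimplex F i (q i)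

  _∣_[_] : ∀ {n} → (Subset n → Carrier) → Profile n → Fin n → Profile n
  (qi ∣ q [ i ]) j = if does (j ≟ i) then qi else q j

  Wi : ∀ {n} → Family n → (Subset n → Carrier) → Fin n → Profile n → Carrier
  Wi {n} F w i q =
    ΣF F (λ A → does (i ∈? A)) λ A →
      q i A * ΣF F (λ B → does (i ∈? B) ∧ does (B ⊆? A)) λ B →
        Π-list (filter (λ j → j ∈? (B without i)) (allFin n)) (λ j → q j A) * mobius F w B

  IsLocalMaximizer : ∀ {n} → Family n → (Subset n → Carrier) → Profile n → Set (c ⊔ ℓ₁ ⊔ ℓ₂)
  IsLocalMaximizer {n} F w q̂ =
    InSimplexN F q̂ ×
    (∀ i (qi : Subset n → Carrier) → InSimplex F i qi →
       Wi F w i (qi ∣ q̂ [ i ]) ≤ Wi F w i q̂)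

  partitionCover : ∀ {n} → Family n → Profile n
  partitionCover P i A = if P A ∧ does (i ∈? A) then 1# else 0#

IsPartition : ∀ {n} → Family n → Set
IsPartition {n} P =
  (∀ A → A ∈ᶠ P → Nonempty A) ×
  (∀ i → Σ (Subset n) λ A → (A ∈ᶠ P × i ∈ A) ×
         (∀ B → B ∈ᶠ P → i ∈ B → B ≡ A))

module Submission where

-- Player i's worth is linear in its own weights, W_i(q_i | q_{-i}) = Σ_A q_i^A · c(A), with
-- c(A) = Σ_{B ∋ i, B ⊆ A} (Π_{j ∈ B∖{i}} q_j^A) μ^w(B). Against the cover p of a partition, a coalition
-- A ∋ i that is not a block has p_j^A = 0 for all j, so only B = {i} survives and c(A) = μ^w({i}) = w({i});
-- for i's own block A_i every product is 1 and Möbius inversion gives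
-- c(A_i) = Σ_{B ⊆ A_i} μ^w(B) − Σ_{B ⊆ A_i∖{i}} μ^w(B) = w(A_i) − Σ_{B ⊆ A_i∖{i}} μ^w(B).
-- The hypothesis says exactly c(A_i) ≥ w({i}), so no convex combination of the c(A) beats c(A_i) = W_i(p).

open import Defs
open import Level using (Level)
open import Data.Nat using (ℕ; zero; suc; s≤s⁻¹) renaming (_≤_ to _≤ℕ_)
open import Data.Nat.Properties using () renaming (≤-trans to ≤ℕ-trans)
open import Data.Bool using (Bool; true; false; if_then_else_; not; _∧_; _∨_)
open import Data.Bool.Properties using (not-¬; ¬-not) renaming (_≟_ to _≟ᵇ_)
open import Data.Fin using (Fin; zero; suc)
open import Data.Fin.Subset
  using (Subset; _∈_; _∉_; _⊆_; _⊂_; ⁅_⁆; ⊥; _─_; ∣_∣; Empty; inside; outside)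
  renaming (_-_ to _without_)
open import Data.Fin.Subset.Properties
  using (_⊆?_; _⊂?_; _∈?_; drop-∷-⊆; out⊂; out⊂in; in⊂in; p⊂q⇒p⊆q; ⊂-irref; ⊆-reflexive; ⊆-antisym; ⊆-min;
         p⊂q⇒∣p∣<∣q∣; ∣p∣≤n; p─q⊆p; x∈p∧x≢y⇒x∈p-y; x∈⁅x⁆; x∈⁅y⁆⇒x≡y; ∉⊥; nonempty?; Empty-unique)
open import Data.Fin.Properties using (_≟_)
open import Data.List using (List; []; _∷_; _++_; map; filter; allFin)
open import Data.List.Membership.Propositional using () renaming (_∈_ to _∈ˡ_)
open import Data.List.Membership.Propositional.Properties using (∈-filter⁺; ∈-filter⁻; ∈-allFin)
open import Data.List.Relation.Unary.Any using (here; there)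
open import Data.Vec using (_∷_; []) renaming (here to hereᵛ; there to thereᵛ)
open import Data.Vec.Properties using (≡-dec; ∷-injectiveˡ; ∷-injectiveʳ)
open import Data.Product using (_×_; _,_; proj₁; proj₂)
open import Data.Sum using (_⊎_; inj₁; inj₂; [_,_]′) renaming (map to ⊎-map)
open import Function using (_⇔_; mk⇔; _∘_)
open import Relation.Nullary using (Dec; yes; no; does; contradiction; _×-dec_; _⊎-dec_)
open import Relation.Nullary.Decidable using (dec-true; dec-false; does-⇔)
open import Relation.Unary using (Pred; Decidable)
open import Relation.Binary using (IsTotalOrder; Poset; DecidableEquality)
import Relation.Binary.PropositionalEquality as ≡
open ≡ using (_≡_; _≢_; refl)
import Algebra.Properties.Ring as RingProperties
import Algebra.Properties.AbelianGroup as AbelianGroupProperties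
import Algebra.Properties.CommutativeSemigroup as CommutativeSemigroupProperties
import Relation.Binary.Reasoning.Setoid as SetoidReasoning
import Relation.Binary.Reasoning.PartialOrder as PosetReasoning

does⇒ : ∀ {a} {A : Set a} (A? : Dec A) → does A? ≡ true → A
does⇒ (yes a) _ = a

∧-true⁻ : ∀ {a b} → a ∧ b ≡ true → a ≡ true × b ≡ true
∧-true⁻ {true} {true} _ = refl , refl

x∈p─q⇒x∉q : ∀ {n} {x : Fin n} (p q : Subset n) → x ∈ p ─ q → x ∉ q
x∈p─q⇒x∉q {x = zero}  (_ ∷ p) (inside ∷ q)  ()
x∈p─q⇒x∉q {x = zero}  (_ ∷ p) (outside ∷ q) _ ()
x∈p─q⇒x∉q {x = suc x} (_ ∷ p) (_ ∷ q) (thereᵛ x∈p─q) (thereᵛ x∈q) = x∈p─q⇒x∉q p q x∈p─q x∈q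

x∈p-y⇒x≢y : ∀ {n} {x y : Fin n} (p : Subset n) → x ∈ p without y → x ≢ y
x∈p-y⇒x≢y {y = y} p x∈p-y refl = x∈p─q⇒x∉q p ⁅ y ⁆ x∈p-y (x∈⁅x⁆ y)

x∈p-y⇒x∈p : ∀ {n} {x y : Fin n} (p : Subset n) → x ∈ p without y → x ∈ p
x∈p-y⇒x∈p {y = y} p = p─q⊆p p ⁅ y ⁆

x∈p∧Empty[p-x]⇒p≡⁅x⁆ : ∀ {n} {p : Subset n} {x : Fin n} → x ∈ p → Empty (p without x) → p ≡ ⁅ x ⁆
x∈p∧Empty[p-x]⇒p≡⁅x⁆ {p = p} {x} x∈p p-x-empty = ⊆-antisym p⊆⁅x⁆ ⁅x⁆⊆p
  where
  p⊆⁅x⁆ : p ⊆ ⁅ x ⁆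
  p⊆⁅x⁆ {y} y∈p with y ≟ x
  ... | yes refl = x∈⁅x⁆ x
  ... | no y≢x   = contradiction (y , x∈p∧x≢y⇒x∈p-y y∈p y≢x) p-x-empty
  ⁅x⁆⊆p : ⁅ x ⁆ ⊆ p
  ⁅x⁆⊆p y∈⁅x⁆ = ≡.subst (_∈ p) (≡.sym (x∈⁅y⁆⇒x≡y x y∈⁅x⁆)) x∈p

Empty[⁅x⁆-x] : ∀ {n} (x : Fin n) → Empty (⁅ x ⁆ without x)
Empty[⁅x⁆-x] x (y , y∈⁅x⁆-x) = x∈p-y⇒x≢y ⁅ x ⁆ y∈⁅x⁆-x (x∈⁅y⁆⇒x≡y x (x∈p-y⇒x∈p ⁅ x ⁆ y∈⁅x⁆-x))

_≟ˢ_ : ∀ {n} → DecidableEquality (Subset n)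
_≟ˢ_ = ≡-dec _≟ᵇ_

⊆⇒⊂⊎≡ : ∀ {n} {p q : Subset n} → p ⊆ q → p ⊂ q ⊎ p ≡ q
⊆⇒⊂⊎≡ {p = []}          {[]}          _   = inj₂ refl
⊆⇒⊂⊎≡ {p = outside ∷ p} {outside ∷ q} p⊆q = ⊎-map out⊂ (≡.cong (outside ∷_)) (⊆⇒⊂⊎≡ (drop-∷-⊆ p⊆q))
⊆⇒⊂⊎≡ {p = outside ∷ p} {inside ∷ q}  p⊆q = inj₁ (out⊂in (drop-∷-⊆ p⊆q))
⊆⇒⊂⊎≡ {p = inside ∷ p}  {outside ∷ q} p⊆q = contradiction (p⊆q hereᵛ) λ ()
⊆⇒⊂⊎≡ {p = inside ∷ p}  {inside ∷ q}  p⊆q = ⊎-map in⊂in (≡.cong (inside ∷_)) (⊆⇒⊂⊎≡ (drop-∷-⊆ p⊆q))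

⊆⇔⊂⊎≡ : ∀ {n} {p q : Subset n} → p ⊆ q ⇔ (p ⊂ q ⊎ p ≡ q)
⊆⇔⊂⊎≡ = mk⇔ ⊆⇒⊂⊎≡ [ p⊂q⇒p⊆q , ⊆-reflexive ]′

⊆⇔∈×⊆⊎⊆- : ∀ {n} {p q : Subset n} (x : Fin n) → p ⊆ q ⇔ ((x ∈ p × p ⊆ q) ⊎ p ⊆ q without x)
⊆⇔∈×⊆⊎⊆- {p = p} {q} x = mk⇔ to [ proj₂ , x∈p-y⇒x∈p q ∘_ ]′
  where
  to : p ⊆ q → (x ∈ p × p ⊆ q) ⊎ p ⊆ q without x
  to p⊆q with x ∈? p
  ... | yes x∈p = inj₁ (x∈p , p⊆q)
  ... | no x∉p  = inj₂ λ y∈p → x∈p∧x≢y⇒x∈p-y (p⊆q y∈p) λ { refl → x∉p y∈p }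

⊂⁅x⁆⇒≡⊥ : ∀ {n} {p : Subset n} {x : Fin n} → p ⊂ ⁅ x ⁆ → p ≡ ⊥
⊂⁅x⁆⇒≡⊥ {p = p} {x} (p⊆⁅x⁆ , y , y∈⁅x⁆ , y∉p) = Empty-unique λ (z , z∈p) →
  y∉p (≡.subst (_∈ p) (≡.trans (x∈⁅y⁆⇒x≡y x (p⊆⁅x⁆ z∈p)) (≡.sym (x∈⁅y⁆⇒x≡y x y∈⁅x⁆))) z∈p)

module _ {c ℓ₁ ℓ₂} (R : OrderedField c ℓ₁ ℓ₂) where
  open OrderedField R renaming (refl to ≈-refl)
  open WithField R
  open IsTotalOrder isTotalOrder using (total; isPartialOrder) renaming (refl to ≤-refl; trans to ≤-trans; reflexive to ≤-reflexive)
  open RingProperties ring using (-1*x≈-x; -‿involutive)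
  open AbelianGroupProperties +-abelianGroup using (ε⁻¹≈ε; //-rightDividesˡ; //-rightDividesʳ)
  open CommutativeSemigroupProperties +-commutativeSemigroup using (interchange)

  ≤-poset : Poset c ℓ₁ ℓ₂
  ≤-poset = record { isPartialOrder = isPartialOrder }

  module ≈-Reasoning = SetoidReasoning setoid
  module ≤-Reasoning = PosetReasoning ≤-poset

  x-0≈x : ∀ x → x - 0# ≈ x
  x-0≈x x = trans (+-congˡ ε⁻¹≈ε) (+-identityʳ x)

  x+[y-x]≈y : ∀ x y → x + (y - x) ≈ y
  x+[y-x]≈y x y = trans (+-comm x (y - x)) (//-rightDividesˡ x y)

  x+y≈z⇒x≈z-y : ∀ {x y z} → x + y ≈ z → x ≈ z - y
  x+y≈z⇒x≈z-y {x} {y} x+y≈z = trans (sym (//-rightDividesʳ y x)) (+-congʳ x+y≈z)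

  +-mono-≤ : ∀ {a b x y} → a ≤ b → x ≤ y → (a + x) ≤ (b + y)
  +-mono-≤ {a} {b} {x} {y} a≤b x≤y = begin
    a + x ≤⟨ +-monoʳ x a≤b ⟩
    b + x ≈⟨ +-comm b x ⟩
    x + b ≤⟨ +-monoʳ b x≤y ⟩
    y + b ≈⟨ +-comm y b ⟩
    b + y ∎
    where open ≤-Reasoning

  x+y≤z⇒x≤z-y : ∀ {x y z} → (x + y) ≤ z → x ≤ (z - y)
  x+y≤z⇒x≤z-y {x} {y} {z} x+y≤z = begin
    x           ≈⟨ sym (//-rightDividesʳ y x) ⟩
    (x + y) - y ≤⟨ +-monoʳ (- y) x+y≤z ⟩
    z - y       ∎
    where open ≤-Reasoning

  0≤1 : 0# ≤ 1#
  0≤1 with total 0# 1#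
  ... | inj₁ 0≤1 = 0≤1
  ... | inj₂ 1≤0 = begin
    0#          ≤⟨ *-nonneg 0≤-1 0≤-1 ⟩
    - 1# * - 1# ≈⟨ -1*x≈-x (- 1#) ⟩
    - - 1#      ≈⟨ -‿involutive 1# ⟩
    1#          ∎
    where
    open ≤-Reasoning
    0≤-1 : 0# ≤ (- 1#)
    0≤-1 = begin
      0#       ≈⟨ sym (-‿inverseʳ 1#) ⟩
      1# - 1#  ≤⟨ +-monoʳ (- 1#) 1≤0 ⟩
      0# - 1#  ≈⟨ +-identityˡ (- 1#) ⟩
      - 1#     ∎

  *-monoˡ-≤-nonneg : ∀ {q a b} → 0# ≤ q → a ≤ b → (q * a) ≤ (q * b)
  *-monoˡ-≤-nonneg {q} {a} {b} 0≤q a≤b = begin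
    q * a                 ≈⟨ sym (+-identityˡ (q * a)) ⟩
    0# + q * a            ≤⟨ +-monoʳ (q * a) (*-nonneg 0≤q 0≤b-a) ⟩
    q * (b - a) + q * a   ≈⟨ sym (distribˡ q (b - a) a) ⟩
    q * ((b - a) + a)     ≈⟨ *-congˡ (//-rightDividesˡ a b) ⟩
    q * b                 ∎
    where
    open ≤-Reasoning
    0≤b-a : 0# ≤ (b - a)
    0≤b-a = begin
      0#     ≈⟨ sym (-‿inverseʳ a) ⟩
      a - a  ≤⟨ +-monoʳ (- a) a≤b ⟩
      b - a  ∎

  module _ {A : Set} where

    Σ-cong-∈ : ∀ (xs : List A) {f g : A → Carrier} →
               (∀ {x} → x ∈ˡ xs → f x ≈ g x) → Σ-list xs f ≈ Σ-list xs g
    Σ-cong-∈ []       f≈g = ≈-refl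
    Σ-cong-∈ (x ∷ xs) f≈g = +-cong (f≈g (here refl)) (Σ-cong-∈ xs (f≈g ∘ there))

    Σ-mono-∈ : ∀ (xs : List A) {f g : A → Carrier} →
               (∀ {x} → x ∈ˡ xs → f x ≤ g x) → Σ-list xs f ≤ Σ-list xs g
    Σ-mono-∈ []       f≤g = ≤-refl
    Σ-mono-∈ (x ∷ xs) f≤g = +-mono-≤ (f≤g (here refl)) (Σ-mono-∈ xs (f≤g ∘ there))

    Σ-0 : ∀ (xs : List A) → Σ-list xs (λ _ → 0#) ≈ 0#
    Σ-0 []       = ≈-refl
    Σ-0 (x ∷ xs) = trans (+-congˡ (Σ-0 xs)) (+-identityʳ 0#)

    Σ-+ : ∀ (xs : List A) (f g : A → Carrier) →
          Σ-list xs (λ x → f x + g x) ≈ Σ-list xs f + Σ-list xs g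
    Σ-+ []       f g = sym (+-identityʳ 0#)
    Σ-+ (x ∷ xs) f g = trans (+-congˡ (Σ-+ xs f g)) (interchange (f x) (g x) _ _)

    Σ-*ˡ : ∀ (xs : List A) (k : Carrier) (f : A → Carrier) →
           Σ-list xs (λ x → k * f x) ≈ k * Σ-list xs f
    Σ-*ˡ []       k f = sym (zeroʳ k)
    Σ-*ˡ (x ∷ xs) k f = trans (+-congˡ (Σ-*ˡ xs k f)) (sym (distribˡ k (f x) _))

    Σ-++ : ∀ (xs ys : List A) (f : A → Carrier) →
           Σ-list (xs ++ ys) f ≈ Σ-list xs f + Σ-list ys f
    Σ-++ []       ys f = sym (+-identityˡ _)
    Σ-++ (x ∷ xs) ys f = trans (+-congˡ (Σ-++ xs ys f)) (sym (+-assoc (f x) _ _))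

    Σ-filter : ∀ {P : Pred A Level.zero} (P? : Decidable P) (xs : List A) (f : A → Carrier) →
               Σ-list (filter P? xs) f ≈ Σ-list xs (λ x → if does (P? x) then f x else 0#)
    Σ-filter P? []       f = ≈-refl
    Σ-filter P? (x ∷ xs) f with does (P? x)
    ... | true  = +-congˡ (Σ-filter P? xs f)
    ... | false = trans (Σ-filter P? xs f) (sym (+-identityˡ _))

    Π-≈1 : ∀ (xs : List A) {f : A → Carrier} → (∀ {x} → x ∈ˡ xs → f x ≈ 1#) → Π-list xs f ≈ 1#
    Π-≈1 []       f≈1 = ≈-refl
    Π-≈1 (x ∷ xs) f≈1 = trans (*-cong (f≈1 (here refl)) (Π-≈1 xs (f≈1 ∘ there))) (*-identityˡ 1#)

    Π-cong-∈ : ∀ (xs : List A) {f g : A → Carrier} →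
               (∀ {x} → x ∈ˡ xs → f x ≈ g x) → Π-list xs f ≈ Π-list xs g
    Π-cong-∈ []       f≈g = ≈-refl
    Π-cong-∈ (x ∷ xs) f≈g = *-cong (f≈g (here refl)) (Π-cong-∈ xs (f≈g ∘ there))

    Π-≈0 : ∀ {xs : List A} {x} (f : A → Carrier) → x ∈ˡ xs → f x ≈ 0# → Π-list xs f ≈ 0#
    Π-≈0 f (here refl) fx≈0 = trans (*-congʳ fx≈0) (zeroˡ _)
    Π-≈0 f (there x∈xs) fx≈0 = trans (*-congˡ (Π-≈0 f x∈xs fx≈0)) (zeroʳ _)

  Σ-map : ∀ {A B : Set} (h : A → B) (xs : List A) (f : B → Carrier) →
          Σ-list (map h xs) f ≈ Σ-list xs (f ∘ h)
  Σ-map h []       f = ≈-refl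
  Σ-map h (x ∷ xs) f = +-congˡ (Σ-map h xs f)

  Σ-allSubsets-single : ∀ n (A : Subset n) (g : Subset n → Carrier) →
                        (∀ B → B ≢ A → g B ≈ 0#) → Σ-list (allSubsets n) g ≈ g A
  Σ-allSubsets-single zero    []      g g≈0 = +-identityʳ _
  Σ-allSubsets-single (suc n) (a ∷ A) g g≈0 = begin
    Σ-list (map (true ∷_) L ++ map (false ∷_) L) g
      ≈⟨ Σ-++ (map (true ∷_) L) _ g ⟩
    Σ-list (map (true ∷_) L) g + Σ-list (map (false ∷_) L) g
      ≈⟨ +-cong (Σ-map (true ∷_) L g) (Σ-map (false ∷_) L g) ⟩
    Σ-list L (g ∘ (true ∷_)) + Σ-list L (g ∘ (false ∷_))
      ≈⟨ by-head a g≈0 ⟩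
    g (a ∷ A) ∎
    where
    open ≈-Reasoning
    L : List (Subset n)
    L = allSubsets n
    single : ∀ b → (∀ B → B ≢ b ∷ A → g B ≈ 0#) → Σ-list L (g ∘ (b ∷_)) ≈ g (b ∷ A)
    single b g≈0 = Σ-allSubsets-single n A (g ∘ (b ∷_)) λ B B≢A → g≈0 _ (B≢A ∘ ∷-injectiveʳ)
    none : ∀ b → (∀ B → B ≢ (not b) ∷ A → g B ≈ 0#) → Σ-list L (g ∘ (b ∷_)) ≈ 0#
    none b g≈0 = trans (Σ-cong-∈ L λ _ → g≈0 _ (not-¬ refl ∘ ∷-injectiveˡ)) (Σ-0 L)
    by-head : ∀ a → (∀ B → B ≢ a ∷ A → g B ≈ 0#) →
              Σ-list L (g ∘ (true ∷_)) + Σ-list L (g ∘ (false ∷_)) ≈ g (a ∷ A)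
    by-head true  g≈0 = trans (+-cong (single true g≈0) (none false g≈0)) (+-identityʳ _)
    by-head false g≈0 = trans (+-cong (none true g≈0) (single false g≈0)) (+-identityˡ _)

  module _ {n : ℕ} (F : Family n) where

    members : (Subset n → Bool) → List (Subset n)
    members t = filter (λ B → F B ∧ t B ≟ᵇ true) (allSubsets n)

    ∈-members⁻ : ∀ {t : Subset n → Bool} {B} → B ∈ˡ members t → B ∈ᶠ F × t B ≡ true
    ∈-members⁻ {t} B∈ = ∧-true⁻ (proj₂ (∈-filter⁻ (λ B → F B ∧ t B ≟ᵇ true) {xs = allSubsets n} B∈))

    ΣF-cong : ∀ t {f g : Subset n → Carrier} →
              (∀ B → B ∈ᶠ F → t B ≡ true → f B ≈ g B) → ΣF F t f ≈ ΣF F t g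
    ΣF-cong t f≈g = Σ-cong-∈ (members t) λ B∈ → let B∈F , tB = ∈-members⁻ B∈ in f≈g _ B∈F tB

    ΣF-mono : ∀ t {f g : Subset n → Carrier} →
              (∀ B → B ∈ᶠ F → t B ≡ true → f B ≤ g B) → ΣF F t f ≤ ΣF F t g
    ΣF-mono t f≤g = Σ-mono-∈ (members t) λ B∈ → let B∈F , tB = ∈-members⁻ B∈ in f≤g _ B∈F tB

    ΣF-zero : ∀ t {f : Subset n → Carrier} →
              (∀ B → B ∈ᶠ F → t B ≡ true → f B ≈ 0#) → ΣF F t f ≈ 0#
    ΣF-zero t f≈0 = trans (ΣF-cong t f≈0) (Σ-0 (members t))

    ΣF-indicator : ∀ t (f : Subset n → Carrier) →
                   ΣF F t f ≈ Σ-list (allSubsets n) (λ B → if F B ∧ t B then f B else 0#)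
    ΣF-indicator t f = trans (Σ-filter _ (allSubsets n) f)
                             (Σ-cong-∈ (allSubsets n) λ {B} _ → does-≟true (F B ∧ t B))
      where
      does-≟true : ∀ b {x} → (if does (b ≟ᵇ true) then x else 0#) ≈ (if b then x else 0#)
      does-≟true true  = ≈-refl
      does-≟true false = ≈-refl

    ΣF-single : ∀ t {f : Subset n → Carrier} A → A ∈ᶠ F → t A ≡ true →
                (∀ B → B ∈ᶠ F → t B ≡ true → B ≢ A → f B ≈ 0#) → ΣF F t f ≈ f A
    ΣF-single t {f} A A∈F tA f≈0 =
      trans (ΣF-indicator t f) (trans (Σ-allSubsets-single n A _ off) on)
      where
      off : ∀ B → B ≢ A → (if F B ∧ t B then f B else 0#) ≈ 0#
      off B B≢A with F B in B∈F | t B in tB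
      ... | true  | true  = f≈0 B B∈F tB B≢A
      ... | true  | false = ≈-refl
      ... | false | _     = ≈-refl
      on : (if F A ∧ t A then f A else 0#) ≈ f A
      on rewrite A∈F | tA = ≈-refl

    ΣF-∨ : ∀ {t t₁ t₂ : Subset n → Bool} (f : Subset n → Carrier) →
           (∀ B → t B ≡ t₁ B ∨ t₂ B) → (∀ B → t₁ B ∧ t₂ B ≡ false) →
           ΣF F t f ≈ ΣF F t₁ f + ΣF F t₂ f
    ΣF-∨ {t} {t₁} {t₂} f t≡t₁∨t₂ disjoint = begin
      ΣF F t f
        ≈⟨ ΣF-indicator t f ⟩
      Σ-list L (λ B → if F B ∧ t B then f B else 0#)
        ≈⟨ Σ-cong-∈ L (λ {B} _ → split B) ⟩
      Σ-list L (λ B → (if F B ∧ t₁ B then f B else 0#) + (if F B ∧ t₂ B then f B else 0#))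
        ≈⟨ Σ-+ L _ _ ⟩
      Σ-list L (λ B → if F B ∧ t₁ B then f B else 0#) + Σ-list L (λ B → if F B ∧ t₂ B then f B else 0#)
        ≈⟨ sym (+-cong (ΣF-indicator t₁ f) (ΣF-indicator t₂ f)) ⟩
      ΣF F t₁ f + ΣF F t₂ f ∎
      where
      open ≈-Reasoning
      L : List (Subset n)
      L = allSubsets n
      split : ∀ B → (if F B ∧ t B then f B else 0#) ≈
                    (if F B ∧ t₁ B then f B else 0#) + (if F B ∧ t₂ B then f B else 0#)
      split B with F B
      ... | false = sym (+-identityʳ 0#)
      ... | true rewrite t≡t₁∨t₂ B with t₁ B | t₂ B | disjoint B
      ...   | true  | false | _ = sym (+-identityʳ (f B))
      ...   | false | true  | _ = sym (+-identityˡ (f B))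
      ...   | false | false | _ = sym (+-identityʳ 0#)

    ΣF-convex-≤ : ∀ t {q c : Subset n → Carrier} {m} →
                  (∀ A → A ∈ᶠ F → t A ≡ true → 0# ≤ q A) → ΣF F t q ≈ 1# →
                  (∀ A → A ∈ᶠ F → t A ≡ true → c A ≤ m) →
                  ΣF F t (λ A → q A * c A) ≤ m
    ΣF-convex-≤ t {q} {c} {m} 0≤q Σq≈1 c≤m = begin
      ΣF F t (λ A → q A * c A) ≤⟨ ΣF-mono t (λ A A∈F tA → *-monoˡ-≤-nonneg (0≤q A A∈F tA) (c≤m A A∈F tA)) ⟩
      ΣF F t (λ A → q A * m)   ≈⟨ ΣF-cong t (λ A _ _ → *-comm (q A) m) ⟩
      ΣF F t (λ A → m * q A)   ≈⟨ Σ-*ˡ (members t) m q ⟩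
      m * ΣF F t q             ≈⟨ *-congˡ Σq≈1 ⟩
      m * 1#                   ≈⟨ *-identityʳ m ⟩
      m                        ∎
      where open ≤-Reasoning

  -- Möbius inversion

  module _ {n : ℕ} (F : Family n) (w : Subset n → Carrier) where

    private
      μ : Subset n → Carrier
      μ = mobius F w

      ⊂-size : ∀ (C A : Subset n) {k} → does (C ⊂? A) ≡ true → ∣ A ∣ ≤ℕ k → suc ∣ C ∣ ≤ℕ k
      ⊂-size C A C⊂A = ≤ℕ-trans (p⊂q⇒∣p∣<∣q∣ (does⇒ (C ⊂? A) C⊂A))

    mobiusFuel-suc : ∀ k (A : Subset n) → ∣ A ∣ ≤ℕ k → mobiusFuel k F w A ≈ mobiusFuel (suc k) F w A
    mobiusFuel-suc zero A ∣A∣≤0 = sym (trans (+-congˡ (-‿cong (ΣF-zero F _ λ C _ C⊂A →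
      contradiction (⊂-size C A C⊂A ∣A∣≤0) λ ()))) (x-0≈x (w A)))
    mobiusFuel-suc (suc k) A ∣A∣≤1+k = +-congˡ (-‿cong (ΣF-cong F _ λ C _ C⊂A →
      mobiusFuel-suc k C (s≤s⁻¹ (⊂-size C A C⊂A ∣A∣≤1+k))))

    -- Fuel n bounds every |A|, and mobiusFuel (suc n) unfolds to the recursion over mobiusFuel n = μ.
    mobius-unfold : ∀ A → μ A ≈ w A - ΣF F (λ C → does (C ⊂? A)) μ
    mobius-unfold A = mobiusFuel-suc n A (∣p∣≤n A)

    mobius-inversion : ∀ A → A ∈ᶠ F → ΣF F (λ B → does (B ⊆? A)) μ ≈ w A
    mobius-inversion A A∈F = begin
      ΣF F (λ B → does (B ⊆? A)) μ     ≈⟨ ΣF-∨ F μ ⊆≡⊂∨≡ ⊂∧≡≡false ⟩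
      T + ΣF F (λ B → does (B ≟ˢ A)) μ ≈⟨ +-congˡ (ΣF-single F _ A A∈F (dec-true (A ≟ˢ A) refl) λ B _ B≡A B≢A →
                                                     contradiction (does⇒ (B ≟ˢ A) B≡A) B≢A) ⟩
      T + μ A                          ≈⟨ +-congˡ (mobius-unfold A) ⟩
      T + (w A - T)                    ≈⟨ x+[y-x]≈y T (w A) ⟩
      w A                              ∎
      where
      open ≈-Reasoning
      T : Carrier
      T = ΣF F (λ C → does (C ⊂? A)) μ
      ⊆≡⊂∨≡ : ∀ B → does (B ⊆? A) ≡ does (B ⊂? A) ∨ does (B ≟ˢ A)
      ⊆≡⊂∨≡ B = does-⇔ ⊆⇔⊂⊎≡ (B ⊆? A) ((B ⊂? A) ⊎-dec (B ≟ˢ A))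
      ⊂∧≡≡false : ∀ B → does (B ⊂? A) ∧ does (B ≟ˢ A) ≡ false
      ⊂∧≡≡false B = dec-false ((B ⊂? A) ×-dec (B ≟ˢ A)) λ (B⊂A , B≡A) → ⊂-irref B≡A B⊂A

    mobius-⊥ : μ ⊥ ≈ w ⊥
    mobius-⊥ = trans (mobius-unfold ⊥) (trans (+-congˡ (-‿cong (ΣF-zero F _ λ C _ C⊂⊥ →
      contradiction (proj₁ (proj₂ (proj₂ (does⇒ (C ⊂? ⊥) C⊂⊥)))) ∉⊥))) (x-0≈x (w ⊥)))

    mobius-⁅⁆ : ⊥ ∈ᶠ F → w ⊥ ≈ 0# → ∀ i → μ ⁅ i ⁆ ≈ w ⁅ i ⁆
    mobius-⁅⁆ ⊥∈F w⊥≈0 i = begin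
      μ ⁅ i ⁆                                     ≈⟨ mobius-unfold ⁅ i ⁆ ⟩
      w ⁅ i ⁆ - ΣF F (λ C → does (C ⊂? ⁅ i ⁆)) μ ≈⟨ +-congˡ (-‿cong below-⁅i⁆) ⟩
      w ⁅ i ⁆ - 0#                                ≈⟨ x-0≈x (w ⁅ i ⁆) ⟩
      w ⁅ i ⁆                                     ∎
      where
      open ≈-Reasoning
      ⊥⊂⁅i⁆ : ⊥ ⊂ ⁅ i ⁆
      ⊥⊂⁅i⁆ = ⊆-min _ , i , x∈⁅x⁆ i , ∉⊥
      below-⁅i⁆ : ΣF F (λ C → does (C ⊂? ⁅ i ⁆)) μ ≈ 0#
      below-⁅i⁆ = trans (ΣF-single F _ ⊥ ⊥∈F (dec-true (⊥ ⊂? ⁅ i ⁆) ⊥⊂⁅i⁆) λ C _ C⊂⁅i⁆ C≢⊥ →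
                          contradiction (⊂⁅x⁆⇒≡⊥ (does⇒ (C ⊂? ⁅ i ⁆) C⊂⁅i⁆)) C≢⊥)
                        (trans mobius-⊥ w⊥≈0)

  module _ {n : ℕ} (F : Family n) (w : Subset n → Carrier) where

    others : Fin n → Subset n → List (Fin n)
    others i B = filter (λ j → j ∈? (B without i)) (allFin n)

    ∈-others⁻ : ∀ {i j B} → j ∈ˡ others i B → j ∈ B without i
    ∈-others⁻ {i} {B = B} = proj₂ ∘ ∈-filter⁻ (λ j → j ∈? (B without i)) {xs = allFin n}

    ∈-others⁺ : ∀ {i j B} → j ∈ B without i → j ∈ˡ others i B
    ∈-others⁺ {i} {j} {B} = ∈-filter⁺ (λ j → j ∈? (B without i)) (∈-allFin j)

    -- The bracket of W_i, so that Wi F w i q is ΣF F (∋ i) (λ A → q i A * payoff F w i q A) by definition.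
    payoff : Fin n → Profile n → Subset n → Carrier
    payoff i q A = ΣF F (λ B → does (i ∈? B) ∧ does (B ⊆? A)) λ B →
      Π-list (others i B) (λ j → q j A) * mobius F w B

    update-≡ : ∀ {i} qi (q : Profile n) → (qi ∣ q [ i ]) i ≡ qi
    update-≡ {i} qi q rewrite dec-true (i ≟ i) refl = refl

    update-≢ : ∀ {i j} qi (q : Profile n) A → j ≢ i → (qi ∣ q [ i ]) j A ≈ q j A
    update-≢ {i} {j} qi q A j≢i rewrite dec-false (j ≟ i) j≢i = ≈-refl

    payoff-update : ∀ i qi q A → payoff i (qi ∣ q [ i ]) A ≈ payoff i q A
    payoff-update i qi q A = ΣF-cong F _ λ B _ _ → *-congʳ (Π-cong-∈ (others i B) λ j∈ →
      update-≢ qi q A (x∈p-y⇒x≢y B (∈-others⁻ j∈)))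

    Wi-deviation : ∀ i qi q → Wi F w i (qi ∣ q [ i ]) ≈ ΣF F (λ A → does (i ∈? A)) (λ A → qi A * payoff i q A)
    Wi-deviation i qi q = ΣF-cong F _ λ A _ _ →
      *-cong (reflexive (≡.cong (λ f → f A) (update-≡ qi q))) (payoff-update i qi q A)

  module _ {n : ℕ} (P : Family n) where

    cover-in : ∀ {j A} → A ∈ᶠ P → j ∈ A → partitionCover P j A ≈ 1#
    cover-in {j} {A} A∈P j∈A rewrite A∈P | dec-true (j ∈? A) j∈A = ≈-refl

    cover-out : ∀ {j A} → P A ≡ false → partitionCover P j A ≈ 0#
    cover-out A∉P rewrite A∉P = ≈-refl

    cover-nonneg : ∀ j A → 0# ≤ partitionCover P j A
    cover-nonneg j A with P A ∧ does (j ∈? A)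
    ... | true  = 0≤1
    ... | false = ≤-refl

  -- Best responses against a partition cover

  module BestResponse {n : ℕ} (F : Family n) (w : Subset n → Carrier)
                      (P : Family n) (P-partition : IsPartition P) (P⊆F : ∀ A → A ∈ᶠ P → A ∈ᶠ F)
                      (i : Fin n) where

    Aᵢ : Subset n
    Aᵢ = proj₁ (proj₂ P-partition i)

    Aᵢ∈P : Aᵢ ∈ᶠ P
    Aᵢ∈P = proj₁ (proj₁ (proj₂ (proj₂ P-partition i)))

    i∈Aᵢ : i ∈ Aᵢ
    i∈Aᵢ = proj₂ (proj₁ (proj₂ (proj₂ P-partition i)))

    private
      μ : Subset n → Carrier
      μ = mobius F w

      p : Profile n
      p = partitionCover P

      block-unique : ∀ B → B ∈ᶠ P → i ∈ B → B ≡ Aᵢ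
      block-unique = proj₂ (proj₂ (proj₂ P-partition i))

      ∋i : Subset n → Bool
      ∋i A = does (i ∈? A)

    ΣF-cover : ∀ (h : Subset n → Carrier) → ΣF F ∋i (λ A → p i A * h A) ≈ h Aᵢ
    ΣF-cover h = trans (ΣF-single F ∋i Aᵢ (P⊆F Aᵢ Aᵢ∈P) (dec-true (i ∈? Aᵢ) i∈Aᵢ) off)
                       (trans (*-congʳ (cover-in P Aᵢ∈P i∈Aᵢ)) (*-identityˡ (h Aᵢ)))
      where
      off : ∀ B → B ∈ᶠ F → ∋i B ≡ true → B ≢ Aᵢ → p i B * h B ≈ 0#
      off B _ i∈B B≢Aᵢ with P B ≟ᵇ true
      ... | yes B∈P = contradiction (block-unique B B∈P (does⇒ (i ∈? B) i∈B)) B≢Aᵢ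
      ... | no B∉P  = trans (*-congʳ (cover-out P {i} (¬-not B∉P))) (zeroˡ (h B))

    payoff-in : ∀ A → A ∈ᶠ P → payoff F w i p A ≈ w A - ΣF F (λ B → does (B ⊆? (A without i))) μ
    payoff-in A A∈P = x+y≈z⇒x≈z-y (begin
      payoff F w i p A + S (A without i)                    ≈⟨ +-congʳ (ΣF-cong F _ λ B _ t → all-in B t) ⟩
      ΣF F (λ B → ∋i B ∧ does (B ⊆? A)) μ + S (A without i) ≈⟨ sym (ΣF-∨ F μ split disjoint) ⟩
      S A                                                   ≈⟨ mobius-inversion F w A (P⊆F A A∈P) ⟩
      w A                                                   ∎)
      where
      open ≈-Reasoning
      S : Subset n → Carrier
      S X = ΣF F (λ B → does (B ⊆? X)) μ
      all-in : ∀ B → ∋i B ∧ does (B ⊆? A) ≡ true → Π-list (others F w i B) (λ j → p j A) * μ B ≈ μ B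
      all-in B t = trans (*-congʳ (Π-≈1 (others F w i B) λ j∈ →
                     cover-in P A∈P (does⇒ (B ⊆? A) (proj₂ (∧-true⁻ t)) (x∈p-y⇒x∈p B (∈-others⁻ F w j∈)))))
                   (*-identityˡ (μ B))
      split : ∀ B → does (B ⊆? A) ≡ (∋i B ∧ does (B ⊆? A)) ∨ does (B ⊆? (A without i))
      split B = does-⇔ (⊆⇔∈×⊆⊎⊆- i) (B ⊆? A) (((i ∈? B) ×-dec (B ⊆? A)) ⊎-dec (B ⊆? (A without i)))
      disjoint : ∀ B → (∋i B ∧ does (B ⊆? A)) ∧ does (B ⊆? (A without i)) ≡ false
      disjoint B = dec-false (((i ∈? B) ×-dec (B ⊆? A)) ×-dec (B ⊆? (A without i)))
        λ ((i∈B , _) , B⊆A-i) → x∈p-y⇒x≢y A (B⊆A-i i∈B) refl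

    payoff-out : ⁅ i ⁆ ∈ᶠ F → ∀ A → P A ≡ false → i ∈ A → payoff F w i p A ≈ μ ⁅ i ⁆
    payoff-out ⁅i⁆∈F A A∉P i∈A =
      trans (ΣF-single F _ ⁅ i ⁆ ⁅i⁆∈F ⁅i⁆-counted others-vanish)
            (trans (*-congʳ (Π-≈1 (others F w i ⁅ i ⁆) λ j∈ →
                             contradiction (_ , ∈-others⁻ F w j∈) (Empty[⁅x⁆-x] i)))
                   (*-identityˡ (μ ⁅ i ⁆)))
      where
      ⁅i⁆⊆A : ⁅ i ⁆ ⊆ A
      ⁅i⁆⊆A j∈⁅i⁆ = ≡.subst (_∈ A) (≡.sym (x∈⁅y⁆⇒x≡y i j∈⁅i⁆)) i∈A
      ⁅i⁆-counted : ∋i ⁅ i ⁆ ∧ does (⁅ i ⁆ ⊆? A) ≡ true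
      ⁅i⁆-counted = dec-true ((i ∈? ⁅ i ⁆) ×-dec (⁅ i ⁆ ⊆? A)) (x∈⁅x⁆ i , ⁅i⁆⊆A)
      others-vanish : ∀ B → B ∈ᶠ F → ∋i B ∧ does (B ⊆? A) ≡ true → B ≢ ⁅ i ⁆ →
                      Π-list (others F w i B) (λ j → p j A) * μ B ≈ 0#
      others-vanish B _ t B≢⁅i⁆ with nonempty? (B without i)
      ... | yes (j , j∈B-i) =
        trans (*-congʳ (Π-≈0 (λ j → p j A) (∈-others⁺ F w j∈B-i) (cover-out P {j} A∉P))) (zeroˡ (μ B))
      ... | no B-i-empty =
        contradiction (x∈p∧Empty[p-x]⇒p≡⁅x⁆ (does⇒ (i ∈? B) (proj₁ (∧-true⁻ t))) B-i-empty) B≢⁅i⁆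

    payoff-≤-block : ⊥ ∈ᶠ F → w ⊥ ≈ 0# → ⁅ i ⁆ ∈ᶠ F →
                     (w ⁅ i ⁆ + ΣF F (λ B → does (B ⊆? (Aᵢ without i))) μ) ≤ w Aᵢ →
                     ∀ A → A ∈ᶠ F → ∋i A ≡ true → payoff F w i p A ≤ payoff F w i p Aᵢ
    payoff-≤-block ⊥∈F w⊥≈0 ⁅i⁆∈F cond A _ i∈A with P A ≟ᵇ true
    ... | yes A∈P =
      ≤-reflexive (reflexive (≡.cong (payoff F w i p) (block-unique A A∈P (does⇒ (i ∈? A) i∈A))))
    ... | no A∉P  = begin
      payoff F w i p A                                 ≈⟨ payoff-out ⁅i⁆∈F A (¬-not A∉P) (does⇒ (i ∈? A) i∈A) ⟩
      μ ⁅ i ⁆                                          ≈⟨ mobius-⁅⁆ F w ⊥∈F w⊥≈0 i ⟩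
      w ⁅ i ⁆                                          ≤⟨ x+y≤z⇒x≤z-y cond ⟩
      w Aᵢ - ΣF F (λ B → does (B ⊆? (Aᵢ without i))) μ ≈⟨ sym (payoff-in Aᵢ Aᵢ∈P) ⟩
      payoff F w i p Aᵢ                                ∎
      where open ≤-Reasoning

    cover-∈-simplex : InSimplex F i (p i)
    cover-∈-simplex = (λ A _ _ → cover-nonneg P i A) ,
                      trans (ΣF-cong F ∋i λ A _ _ → sym (*-identityʳ (p i A))) (ΣF-cover (λ _ → 1#))

    cover-best-response : ⊥ ∈ᶠ F → w ⊥ ≈ 0# → ⁅ i ⁆ ∈ᶠ F →
                          (w ⁅ i ⁆ + ΣF F (λ B → does (B ⊆? (Aᵢ without i))) μ) ≤ w Aᵢ →
                          ∀ qi → InSimplex F i qi → Wi F w i (qi ∣ p [ i ]) ≤ Wi F w i p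
    cover-best-response ⊥∈F w⊥≈0 ⁅i⁆∈F cond qi (0≤qi , Σqi≈1) = begin
      Wi F w i (qi ∣ p [ i ])                      ≈⟨ Wi-deviation F w i qi p ⟩
      ΣF F ∋i (λ A → qi A * payoff F w i p A)      ≤⟨ ΣF-convex-≤ F ∋i 0≤qi′ Σqi≈1 (payoff-≤-block ⊥∈F w⊥≈0 ⁅i⁆∈F cond) ⟩
      payoff F w i p Aᵢ                            ≈⟨ sym (ΣF-cover (payoff F w i p)) ⟩
      Wi F w i p                                   ∎
      where
      open ≤-Reasoning
      0≤qi′ : ∀ A → A ∈ᶠ F → ∋i A ≡ true → 0# ≤ qi A
      0≤qi′ A A∈F i∈A = 0≤qi A A∈F (does⇒ (i ∈? A) i∈A)

proposition16 : ∀ {c ℓ₁ ℓ₂ : Level} (R : OrderedField c ℓ₁ ℓ₂) →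
  let open OrderedField R
      open WithField R
  in (n : ℕ) (F : Family n) →
     ⊥ ∈ᶠ F → (∀ (i : Fin n) → ⁅ i ⁆ ∈ᶠ F) →
     (w : Subset n → Carrier) →
     (∀ A → A ∈ᶠ F → 0# ≤ w A) → w ⊥ ≈ 0# →
     (P : Family n) → IsPartition P → (∀ A → A ∈ᶠ P → A ∈ᶠ F) →
     (∀ A (i : Fin n) → A ∈ᶠ P → i ∈ A →
        (w ⁅ i ⁆ + ΣF F (λ B → does (B ⊆? (A without i))) (mobius F w)) ≤ w A) →
     IsLocalMaximizer F w (partitionCover P)
proposition16 R n F ⊥∈F ⁅⁆∈F w _ w⊥≈0 P P-partition P⊆F cond =
  (λ i → cover-∈-simplex i) ,
  (λ i → cover-best-response i ⊥∈F w⊥≈0 (⁅⁆∈F i) (cond (Aᵢ i) i (Aᵢ∈P i) (i∈Aᵢ i)))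
  where open BestResponse R F w P P-partition P⊆F
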